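{- Let $\Sigma$ and $\Delta$ be disjoint alphabets and let $v_m\in(\Sigma\uplus\Delta)^\ast$ be a word of the form $u_1x_1u_2x_2\cdots u_mx_m$ with $m\in\mathbb{N}$, $u_i\in\Sigma^+$, $x_i\in\Delta^+$ and $|x_i|<|x_{i+1}|$ for all $i$. If there exist words $w_1,\dots,w_n\in(\Sigma\uplus\Delta)^\ast$ such that $v_m\in w_1^\ast\cdots w_n^\ast$, then $\sum_{i=1}^n|w_i|\geq m$. -}

module Defs where

open import Data.Nat using (ℕ; zero; suc; _<_)
open import Data.Nat.ListAction using (sum)
open import Data.Fin using (Fin)
open import Data.List using (List; []; _++_; map; concat; length)
open import Data.Sum using (_⊎_; inj₁; inj₂)
open import Data.Product using (∃)
open import Data.Vec.Functional using (toList)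
open import Relation.Binary.PropositionalEquality using (_≡_)

pow : {A : Set} → List A → ℕ → List A
pow w zero = []
pow w (suc k) = w ++ pow w k

NonEmpty : {A : Set} → List A → Set
NonEmpty w = 0 < length w

block : {Σ Δ : Set} → List Σ → List Δ → List (Σ ⊎ Δ)
block u x = map inj₁ u ++ map inj₂ x

vWord : {Σ Δ : Set} (m : ℕ) → (Fin m → List Σ) → (Fin m → List Δ) → List (Σ ⊎ Δ)
vWord m u x = concat (toList (λ i → block (u i) (x i)))

InStarProduct : {A : Set} (n : ℕ) → List A → (Fin n → List A) → Set
InStarProduct n v w = ∃ λ (k : Fin n → ℕ) → v ≡ concat (toList (λ i → pow (w i) (k i)))

totalLength : {A : Set} (n : ℕ) → (Fin n → List A) → ℕ
totalLength n w = sum (toList (λ i → length (w i)))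

-- Count the positions of a word where a Σ-letter is immediately followed by a Δ-letter.
-- Each block u_i x_i of v_m contributes one such switch, so v_m has at least m of them.
-- In a factorisation v_m = w_1^{k_1} ⋯ w_n^{k_n}, attribute a switch straddling two
-- factors to the left one; then w^k carries at most |w| switches.  For k ≤ 2 this is
-- counting (a switch uses two consecutive letters), and for k ≥ 3 the word w cannot
-- contain both kinds of letters: writing w = a s b with s ∈ Σ, the cube w^3 contains
-- s c s c s with c = b a, so a Δ-letter in c would make the same maximal Δ-block
-- length occur twice in v_m, whose Δ-block lengths |x_1| < ⋯ < |x_m| are distinct.
module Submission where

open import Defs
open import Data.Bool using (Bool; true; false; _∧_)
open import Data.Empty using (⊥)
open import Data.Fin using (Fin; toℕ; zero; suc)
open import Data.List using (List; []; _∷_; _++_; map; concat; length)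
open import Data.List.Properties using (++-assoc; ++-identityʳ)
open import Data.List.Relation.Unary.All as All using (All; []; _∷_)
import Data.List.Relation.Unary.All.Properties as All
open import Data.List.Relation.Unary.AllPairs using (AllPairs; []; _∷_)
open import Data.List.Relation.Unary.Linked using (Linked; []; [-]; _∷_)
open import Data.List.Relation.Unary.Linked.Properties using (Linked⇒AllPairs)
open import Data.Nat using (ℕ; zero; suc; _+_; _<_; _≤_; _≥_; z≤n; s≤s)
open import Data.Nat.Properties
open import Data.Product using (_,_)
open import Data.Sum using (_⊎_; inj₁; inj₂)
open import Data.Unit using (⊤)
open import Data.Vec.Functional using (toList; tail)
open import Relation.Binary.Core using (Rel)
open import Relation.Binary.PropositionalEquality
open import Relation.Nullary using (¬_; contradiction)

Linked-toList : ∀ {A : Set} {ℓ} {R : Rel A ℓ} n (f : Fin n → A) →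
                (∀ i j → toℕ j ≡ suc (toℕ i) → R (f i) (f j)) → Linked R (toList f)
Linked-toList zero          f succ = []
Linked-toList (suc zero)    f succ = [-]
Linked-toList (suc (suc n)) f succ =
  succ zero (suc zero) refl ∷
  Linked-toList (suc n) (λ i → f (suc i)) (λ i j e → succ (suc i) (suc j) (cong suc e))

AllPairs-repeat⇒[] : ∀ {A : Set} {ℓ} {R : Rel A ℓ} → (∀ {y} → ¬ R y y) →
                     ∀ xs ys zs → AllPairs R (xs ++ ys ++ ys ++ zs) → ys ≡ []
AllPairs-repeat⇒[] irr []       []       zs _         = refl
AllPairs-repeat⇒[] irr []       (y ∷ ys) zs (Ry∷ ∷ _) =
  contradiction (All.head (All.++⁻ʳ ys Ry∷)) irr
AllPairs-repeat⇒[] irr (_ ∷ xs) ys       zs (_ ∷ p)   = AllPairs-repeat⇒[] irr xs ys zs p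

All-pow : ∀ {A : Set} {P : A → Set} {w} k → All P w → All P (pow w k)
All-pow zero    _  = []
All-pow (suc k) pw = All.++⁺ pw (All-pow k pw)

module _ {A : Set} (a : List A) (s : A) (b : List A) where

  pow-suc-++ : ∀ j R → pow (a ++ s ∷ b) (suc j) ++ R ≡ a ++ s ∷ b ++ pow (a ++ s ∷ b) j ++ R
  pow-suc-++ j R = trans (++-assoc (a ++ s ∷ b) _ R) (++-assoc a (s ∷ b) _)

  pow-suc-rotate : ∀ j R → b ++ pow (a ++ s ∷ b) (suc j) ++ R ≡
                           (b ++ a) ++ s ∷ b ++ pow (a ++ s ∷ b) j ++ R
  pow-suc-rotate j R = trans (cong (b ++_) (pow-suc-++ j R)) (sym (++-assoc b a _))

  pow-cube : ∀ j R → pow (a ++ s ∷ b) (3 + j) ++ R ≡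
             a ++ s ∷ (b ++ a) ++ s ∷ (b ++ a) ++ s ∷ b ++ pow (a ++ s ∷ b) j ++ R
  pow-cube j R = begin
    pow w (3 + j) ++ R
      ≡⟨ pow-suc-++ (2 + j) R ⟩
    a ++ s ∷ b ++ pow w (2 + j) ++ R
      ≡⟨ cong (λ t → a ++ s ∷ t) (pow-suc-rotate (1 + j) R) ⟩
    a ++ s ∷ c ++ s ∷ b ++ pow w (1 + j) ++ R
      ≡⟨ cong (λ t → a ++ s ∷ c ++ s ∷ t) (pow-suc-rotate j R) ⟩
    a ++ s ∷ c ++ s ∷ c ++ s ∷ b ++ pow w j ++ R
      ∎
    where
    open ≡-Reasoning
    w c : List A
    w = a ++ s ∷ b
    c = b ++ a

bit : Bool → ℕ
bit false = 0
bit true  = 1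

bit≤1 : ∀ b → bit b ≤ 1
bit≤1 false = z≤n
bit≤1 true  = ≤-refl

module _ {Σ Δ : Set} where

  Letter : Set
  Letter = Σ ⊎ Δ

  Word : Set
  Word = List Letter

  IsΣ IsΔ : Letter → Set
  IsΣ (inj₁ _) = ⊤
  IsΣ (inj₂ _) = ⊥
  IsΔ (inj₁ _) = ⊥
  IsΔ (inj₂ _) = ⊤

  flush : ℕ → List ℕ
  flush zero    = []
  flush (suc k) = suc k ∷ []

  -- The lengths of the maximal Δ-blocks of s, when s is preceded by k Δ-letters.
  runsFrom : ℕ → Word → List ℕ
  runsFrom k []           = flush k
  runsFrom k (inj₁ _ ∷ s) = flush k ++ runsFrom 0 s
  runsFrom k (inj₂ _ ∷ s) = runsFrom (suc k) s

  runs : Word → List ℕ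
  runs = runsFrom 0

  flush-nonzero : ∀ {k} → 0 < k → flush k ≡ k ∷ []
  flush-nonzero {suc k} _ = refl

  runsFrom-σ : ∀ k p a q → runsFrom k (p ++ inj₁ a ∷ q) ≡ runsFrom k p ++ runs q
  runsFrom-σ k []           a q = refl
  runsFrom-σ k (inj₁ _ ∷ p) a q = trans (cong (flush k ++_) (runsFrom-σ 0 p a q))
                                        (sym (++-assoc (flush k) (runs p) (runs q)))
  runsFrom-σ k (inj₂ _ ∷ p) a q = runsFrom-σ (suc k) p a q

  runsFrom-suc≢[] : ∀ k s → runsFrom (suc k) s ≢ []
  runsFrom-suc≢[] k []           ()
  runsFrom-suc≢[] k (inj₁ _ ∷ s) ()
  runsFrom-suc≢[] k (inj₂ _ ∷ s) = runsFrom-suc≢[] (suc k) s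

  runs≡[]⇒allΣ : ∀ s → runs s ≡ [] → All IsΣ s
  runs≡[]⇒allΣ []           _  = []
  runs≡[]⇒allΣ (inj₁ _ ∷ s) eq = _ ∷ runs≡[]⇒allΣ s eq
  runs≡[]⇒allΣ (inj₂ _ ∷ s) eq = contradiction eq (runsFrom-suc≢[] 0 s)

  runs-Σs : ∀ (u : List Σ) s → runs (map inj₁ u ++ s) ≡ runs s
  runs-Σs []      s = refl
  runs-Σs (_ ∷ u) s = runs-Σs u s

  runsFrom-Δs : ∀ k (x : List Δ) s → runsFrom k (map inj₂ x ++ s) ≡ runsFrom (k + length x) s
  runsFrom-Δs k []      s = cong (λ j → runsFrom j s) (sym (+-identityʳ k))
  runsFrom-Δs k (_ ∷ x) s = trans (runsFrom-Δs (suc k) x s)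
                                  (cong (λ j → runsFrom j s) (sym (+-suc k (length x))))

  runsFrom-block : ∀ k u x s → NonEmpty u →
                   runsFrom k (block u x ++ s) ≡ flush k ++ runsFrom (length x) s
  runsFrom-block k (a ∷ u) x s _ = cong (flush k ++_) (begin
    runs ((map inj₁ u ++ map inj₂ x) ++ s)  ≡⟨ cong runs (++-assoc (map inj₁ u) (map inj₂ x) s) ⟩
    runs (map inj₁ u ++ map inj₂ x ++ s)    ≡⟨ runs-Σs u (map inj₂ x ++ s) ⟩
    runs (map inj₂ x ++ s)                  ≡⟨ runsFrom-Δs 0 x s ⟩
    runsFrom (length x) s                   ∎)
    where open ≡-Reasoning

  runsFrom-vWord : ∀ k m (u : Fin m → List Σ) (x : Fin m → List Δ) →
                   (∀ i → NonEmpty (u i)) → (∀ i → NonEmpty (x i)) →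
                   runsFrom k (vWord m u x) ≡ flush k ++ toList (λ i → length (x i))
  runsFrom-vWord k zero    u x _  _  = sym (++-identityʳ (flush k))
  runsFrom-vWord k (suc m) u x ue xe = begin
    runsFrom k (block (u zero) (x zero) ++ vWord m (tail u) (tail x))
      ≡⟨ runsFrom-block k (u zero) (x zero) _ (ue zero) ⟩
    flush k ++ runsFrom (length (x zero)) (vWord m (tail u) (tail x))
      ≡⟨ cong (flush k ++_)
              (runsFrom-vWord _ m (tail u) (tail x) (λ i → ue (suc i)) (λ i → xe (suc i))) ⟩
    flush k ++ flush (length (x zero)) ++ lengths
      ≡⟨ cong (λ r → flush k ++ r ++ lengths) (flush-nonzero (xe zero)) ⟩
    flush k ++ length (x zero) ∷ lengths
      ∎
    where
    open ≡-Reasoning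
    lengths : List ℕ
    lengths = toList (λ i → length (tail x i))

  runs-cube : ∀ X s c q → runs (X ++ inj₁ s ∷ c ++ inj₁ s ∷ c ++ inj₁ s ∷ q) ≡
                          runs X ++ runs c ++ runs c ++ runs q
  runs-cube X s c q = begin
    runs (X ++ inj₁ s ∷ c ++ inj₁ s ∷ c ++ inj₁ s ∷ q)
      ≡⟨ runsFrom-σ 0 X s _ ⟩
    runs X ++ runs (c ++ inj₁ s ∷ c ++ inj₁ s ∷ q)
      ≡⟨ cong (runs X ++_) (runsFrom-σ 0 c s _) ⟩
    runs X ++ runs c ++ runs (c ++ inj₁ s ∷ q)
      ≡⟨ cong (λ t → runs X ++ runs c ++ t) (runsFrom-σ 0 c s q) ⟩
    runs X ++ runs c ++ runs c ++ runs q
      ∎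
    where open ≡-Reasoning

  cube⇒allΣ : ∀ P a s b j R → AllPairs _<_ (runs (P ++ pow (a ++ inj₁ s ∷ b) (3 + j) ++ R)) →
              All IsΣ (a ++ inj₁ s ∷ b)
  cube⇒allΣ P a s b j R increasing = All.++⁺ (All.++⁻ʳ b c-allΣ) (_ ∷ All.++⁻ˡ b c-allΣ)
    where
    unfolded : runs (P ++ pow (a ++ inj₁ s ∷ b) (3 + j) ++ R) ≡
               runs (P ++ a) ++ runs (b ++ a) ++ runs (b ++ a) ++ runs (b ++ pow (a ++ inj₁ s ∷ b) j ++ R)
    unfolded = trans (cong runs (trans (cong (P ++_) (pow-cube a (inj₁ s) b j R))
                                       (sym (++-assoc P a _))))
                     (runs-cube (P ++ a) s (b ++ a) _)
    c-allΣ : All IsΣ (b ++ a)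
    c-allΣ = runs≡[]⇒allΣ (b ++ a)
               (AllPairs-repeat⇒[] (<-irrefl refl) (runs (P ++ a)) (runs (b ++ a)) _
                                   (subst (AllPairs _<_) unfolded increasing))

  startsWithΔ : Word → Bool → Bool
  startsWithΔ []           b = b
  startsWithΔ (inj₁ _ ∷ _) _ = false
  startsWithΔ (inj₂ _ ∷ _) _ = true

  -- switches s b counts the positions of s holding a Σ-letter followed by a Δ-letter,
  -- where b says whether s itself is followed by a Δ-letter.
  switches : Word → Bool → ℕ
  switches []           _ = 0
  switches (inj₁ _ ∷ s) b = bit (startsWithΔ s b) + switches s b
  switches (inj₂ _ ∷ s) b = switches s b

  startsWithΔ-++ : ∀ x y b → startsWithΔ (x ++ y) b ≡ startsWithΔ x (startsWithΔ y b)
  startsWithΔ-++ []           y b = refl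
  startsWithΔ-++ (inj₁ _ ∷ x) y b = refl
  startsWithΔ-++ (inj₂ _ ∷ x) y b = refl

  switches-++ : ∀ x y b → switches (x ++ y) b ≡ switches x (startsWithΔ y b) + switches y b
  switches-++ []           y b = refl
  switches-++ (inj₂ _ ∷ x) y b = switches-++ x y b
  switches-++ (inj₁ _ ∷ x) y b = begin
    bit (startsWithΔ (x ++ y) b) + switches (x ++ y) b
      ≡⟨ cong₂ _+_ (cong bit (startsWithΔ-++ x y b)) (switches-++ x y b) ⟩
    bit (startsWithΔ x b′) + (switches x b′ + switches y b)
      ≡⟨ sym (+-assoc (bit (startsWithΔ x b′)) (switches x b′) (switches y b)) ⟩
    bit (startsWithΔ x b′) + switches x b′ + switches y b
      ∎
    where
    open ≡-Reasoning
    b′ : Bool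
    b′ = startsWithΔ y b

  switches≤length : ∀ s b → switches s b ≤ length s
  switches≤length []           b = z≤n
  switches≤length (inj₁ _ ∷ s) b = +-mono-≤ (bit≤1 (startsWithΔ s b)) (switches≤length s b)
  switches≤length (inj₂ _ ∷ s) b = m≤n⇒m≤1+n (switches≤length s b)

  switches+switches≤length : ∀ s b c → switches s b + switches s c ≤ length s + bit (b ∧ c)
  switches+switches≤length []                    b     c     = z≤n
  switches+switches≤length (inj₂ _ ∷ s)          b     c     = m≤n⇒m≤1+n (switches+switches≤length s b c)
  switches+switches≤length (inj₁ _ ∷ [])         false false = z≤n
  switches+switches≤length (inj₁ _ ∷ [])         false true  = ≤-refl
  switches+switches≤length (inj₁ _ ∷ [])         true  false = ≤-refl
  switches+switches≤length (inj₁ _ ∷ [])         true  true  = ≤-refl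
  switches+switches≤length (inj₁ _ ∷ inj₁ a ∷ s) b     c     =
    m≤n⇒m≤1+n (switches+switches≤length (inj₁ a ∷ s) b c)
  switches+switches≤length (inj₁ _ ∷ inj₂ _ ∷ s) b     c
    rewrite +-suc (switches s b) (switches s c) = s≤s (s≤s (switches+switches≤length s b c))

  switches-square≤length : ∀ w b → switches (w ++ w) b ≤ length w
  switches-square≤length w b rewrite switches-++ w w b = square w
    where
    square : ∀ w → switches w (startsWithΔ w b) + switches w b ≤ length w
    square []           = z≤n
    square (inj₁ a ∷ w) = ≤-trans (switches+switches≤length (inj₁ a ∷ w) false b)
                                  (≤-reflexive (+-identityʳ (length (inj₁ a ∷ w))))
    square (inj₂ _ ∷ w) = ≤-trans (switches+switches≤length w true b)
                                  (≤-trans (+-monoʳ-≤ (length w) (bit≤1 b))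
                                           (≤-reflexive (+-comm (length w) 1)))

  switches-allΔ : ∀ s b → All IsΔ s → switches s b ≡ 0
  switches-allΔ []           b []        = refl
  switches-allΔ (inj₂ _ ∷ s) b (_ ∷ δs) = switches-allΔ s b δs

  switches-allΣ : ∀ s b → All IsΣ s → switches s b ≤ 1
  switches-allΣ []                    b []           = z≤n
  switches-allΣ (inj₁ _ ∷ [])         b _            = ≤-trans (≤-reflexive (+-identityʳ (bit b))) (bit≤1 b)
  switches-allΣ (inj₁ _ ∷ inj₁ a ∷ s) b (_ ∷ σs)     = switches-allΣ (inj₁ a ∷ s) b σs
  switches-allΣ (inj₁ _ ∷ inj₂ _ ∷ s) b (_ ∷ () ∷ _)
  switches-allΣ (inj₂ _ ∷ s)          b (() ∷ _)

  1≤switches-block : ∀ u x b → NonEmpty u → NonEmpty x → 1 ≤ switches (block u x) b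
  1≤switches-block (_ ∷ [])     (_ ∷ _) b _ _  = s≤s z≤n
  1≤switches-block (_ ∷ a ∷ u)  x       b _ xe = 1≤switches-block (a ∷ u) x b (s≤s z≤n) xe

  m≤switches-vWord : ∀ m (u : Fin m → List Σ) (x : Fin m → List Δ) b →
                     (∀ i → NonEmpty (u i)) → (∀ i → NonEmpty (x i)) →
                     m ≤ switches (vWord m u x) b
  m≤switches-vWord zero    u x b _  _  = z≤n
  m≤switches-vWord (suc m) u x b ue xe
    rewrite switches-++ (block (u zero) (x zero)) (vWord m (tail u) (tail x)) b =
    +-mono-≤ (1≤switches-block (u zero) (x zero) _ (ue zero) (xe zero))
             (m≤switches-vWord m (tail u) (tail x) b (λ i → ue (suc i)) (λ i → xe (suc i)))

  data SplitAtΣ : Word → Set where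
    noΣ : ∀ {w} → All IsΔ w → SplitAtΣ w
    atΣ : ∀ a s b → SplitAtΣ (a ++ inj₁ s ∷ b)

  splitAtΣ : ∀ w → SplitAtΣ w
  splitAtΣ []           = noΣ []
  splitAtΣ (inj₁ s ∷ w) = atΣ [] s w
  splitAtΣ (inj₂ d ∷ w) with splitAtΣ w
  ... | noΣ δs    = noΣ (_ ∷ δs)
  ... | atΣ a s b = atΣ (inj₂ d ∷ a) s b

  switches-pow≤length : ∀ P w k R b → AllPairs _<_ (runs (P ++ pow w k ++ R)) →
                        switches (pow w k) b ≤ length w
  switches-pow≤length P w 0 R b _ = z≤n
  switches-pow≤length P w 1 R b _ rewrite ++-identityʳ w = switches≤length w b
  switches-pow≤length P w 2 R b _ rewrite ++-identityʳ w = switches-square≤length w b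
  switches-pow≤length P w (suc (suc (suc j))) R b increasing with splitAtΣ w
  ... | noΣ δs    = ≤-trans (≤-reflexive (switches-allΔ _ b (All-pow (3 + j) δs))) z≤n
  ... | atΣ p s q = ≤-trans (switches-allΣ _ b (All-pow (3 + j) (cube⇒allΣ P p s q j R increasing)))
                            (nonempty p)
    where
    nonempty : ∀ p → NonEmpty (p ++ inj₁ s ∷ q)
    nonempty []      = s≤s z≤n
    nonempty (_ ∷ _) = s≤s z≤n

  starWord : ∀ n → (Fin n → Word) → (Fin n → ℕ) → Word
  starWord n w k = concat (toList (λ i → pow (w i) (k i)))

  switches-starWord≤totalLength : ∀ n w k P b → AllPairs _<_ (runs (P ++ starWord n w k)) →
                                  switches (starWord n w k) b ≤ totalLength n w
  switches-starWord≤totalLength zero    w k P b _          = z≤n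
  switches-starWord≤totalLength (suc n) w k P b increasing = begin
    switches (pow (w zero) (k zero) ++ rest) b
      ≡⟨ switches-++ (pow (w zero) (k zero)) rest b ⟩
    switches (pow (w zero) (k zero)) (startsWithΔ rest b) + switches rest b
      ≤⟨ +-mono-≤ (switches-pow≤length P (w zero) (k zero) rest _ increasing)
                  (switches-starWord≤totalLength n (tail w) (tail k) (P ++ pow (w zero) (k zero)) b
                    (subst (λ v → AllPairs _<_ (runs v)) (sym (++-assoc P _ rest)) increasing)) ⟩
    length (w zero) + totalLength n (tail w)
      ∎
    where
    open ≤-Reasoning
    rest : Word
    rest = starWord n (tail w) (tail k)

lemma13 : {Σ Δ : Set} (m : ℕ) (u : Fin m → List Σ) (x : Fin m → List Δ)
          → (∀ i → NonEmpty (u i))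
          → (∀ i → NonEmpty (x i))
          → (∀ (i j : Fin m) → toℕ j ≡ suc (toℕ i) → length (x i) < length (x j))
          → (n : ℕ) (w : Fin n → List (Σ ⊎ Δ))
          → InStarProduct n (vWord m u x) w
          → totalLength n w ≥ m
lemma13 m u x ue xe increasing n w (k , v≡) = begin
  m                                ≤⟨ m≤switches-vWord m u x false ue xe ⟩
  switches (vWord m u x) false     ≡⟨ cong (λ v → switches v false) v≡ ⟩
  switches (starWord n w k) false  ≤⟨ switches-starWord≤totalLength n w k [] false runs-increasing ⟩
  totalLength n w                  ∎
  where
  open ≤-Reasoning
  runs-increasing : AllPairs _<_ (runs (starWord n w k))
  runs-increasing = subst (λ v → AllPairs _<_ (runs v)) v≡
    (subst (AllPairs _<_) (sym (runsFrom-vWord 0 m u x ue xe))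
      (Linked⇒AllPairs <-trans (Linked-toList m (λ i → length (x i)) increasing)))
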